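{- Let $X$ and $Y$ be nonmodular flats of a matroid $\mathcal{M}=(Q,r)$. If $X$ is a line (a flat of rank $2$) or $Y$ is a hyperplane, then $X$ is a quasi-intersection of $(X,Y)$ in $\mathcal{M}$.
   Context: Write $AB=A\cup B$ and $r(A|B)=r(AB)-r(B)$. A flat is a set $F$ with $r(Fx)>r(F)$ for all $x\notin F$; a hyperplane is a flat of rank $r(Q)-1$; flats $X,Y$ are modular if $r(X)+r(Y)=r(XY)+r(X\cap Y)$, nonmodular otherwise. A quasi-intersection of a nonmodular pair of flats $(X,Y)$ is a flat $T$ with (DL1) $r(T|X)=0$ and (DL2) for every flat $X'\subseteq X$: $r(T|X')=0$ if and only if $r(Y|X')=r(Y|X)$. -}

module Defs where

open import Data.Nat using (ℕ; _+_; _∸_; _≤_; _<_)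
open import Data.Fin.Subset using (Subset; _∪_; _∩_; _⊆_; _∉_; ⁅_⁆; ⊤; ∣_∣)
open import Data.Product using (_×_)
open import Relation.Binary.PropositionalEquality using (_≡_)
open import Relation.Nullary using (¬_)
open import Function.Bundles using (_⇔_)

record Matroid (n : ℕ) : Set where
  field
    r          : Subset n → ℕ
    r-bounded  : ∀ A → r A ≤ ∣ A ∣
    r-mono     : ∀ {A B} → A ⊆ B → r A ≤ r B
    r-submod   : ∀ A B → r (A ∪ B) + r (A ∩ B) ≤ r A + r B

module _ {n : ℕ} (M : Matroid n) where
  open Matroid M

  -- conditional rank r(A|B) = r(AB) - r(B)  (nonnegative by monotonicity)
  rc : Subset n → Subset n → ℕ
  rc A B = r (A ∪ B) ∸ r B

  IsFlat : Subset n → Set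
  IsFlat F = ∀ x → x ∉ F → r F < r (F ∪ ⁅ x ⁆)

  IsLine : Subset n → Set
  IsLine F = IsFlat F × r F ≡ 2

  IsHyperplane : Subset n → Set
  IsHyperplane F = IsFlat F × r F + 1 ≡ r ⊤

  Modular : Subset n → Subset n → Set
  Modular X Y = r X + r Y ≡ r (X ∪ Y) + r (X ∩ Y)

  Nonmodular : Subset n → Subset n → Set
  Nonmodular X Y = ¬ Modular X Y

  IsQuasiIntersection : Subset n → Subset n → Subset n → Set
  IsQuasiIntersection X Y T =
    IsFlat T
    × rc T X ≡ 0
    × (∀ X′ → IsFlat X′ → X′ ⊆ X → (rc T X′ ≡ 0 ⇔ rc Y X′ ≡ rc Y X))

{-# OPTIONS --safe #-}
-- Since X′ ⊆ X, r(X|X′) = 0 says r(X′) = r(X); then X′ and X span alike, so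
-- r(Y|X′) = r(Y|X).  Conversely let r(Y|X′) = r(Y|X).  Nonmodularity means
-- r(Y|X) < r(Y) - r(X ∩ Y), so X′ ⊄ X ∩ Y, and as Y is a flat, r(YX′) > r(Y).
-- If Y is a hyperplane this forces r(YX′) = r(YX) = r(Q), hence r(X′) = r(X).
-- If X is a line and r(X′) ≤ 1, then r(Y|X′) ≥ r(Y) > r(Y|X), which is absurd.

module Submission where

open import Defs
open import Data.Nat using (ℕ; _+_; _∸_; _≤_; _<_; suc; _≤?_)
open import Data.Nat.Properties
open import Data.Fin.Subset using (Subset; _∪_; _∩_; _⊆_; _∈_; ⁅_⁆; ⊤)
open import Data.Fin.Subset.Properties
  using (p⊆p∪q; q⊆p∪q; x∈p∪q⁻; x∈p∩q⁺; ⊆-refl; ⊆-trans; ⊆⊤; x∈⁅y⁆⇒x≡y; ∪-comm; _∈?_)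
open import Data.Sum using (_⊎_; inj₁; inj₂; [_,_])
open import Data.Product using (_,_)
open import Data.Empty using (⊥-elim)
open import Relation.Nullary using (yes; no)
open import Relation.Binary.PropositionalEquality
  using (_≡_; refl; sym; trans; cong; cong₂; subst; module ≡-Reasoning)
open import Function.Base using (_∘_)
open import Function.Bundles using (mk⇔)

∪-least : ∀ {n} {A B C : Subset n} → A ⊆ C → B ⊆ C → A ∪ B ⊆ C
∪-least {A = A} {B} A⊆C B⊆C x∈A∪B = [ A⊆C , B⊆C ] (x∈p∪q⁻ A B x∈A∪B)

∩-greatest : ∀ {n} {A B C : Subset n} → A ⊆ B → A ⊆ C → A ⊆ B ∩ C
∩-greatest A⊆B A⊆C x∈A = x∈p∩q⁺ (A⊆B x∈A , A⊆C x∈A)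

x∈p⇒⁅x⁆⊆p : ∀ {n} {A : Subset n} {x} → x ∈ A → ⁅ x ⁆ ⊆ A
x∈p⇒⁅x⁆⊆p {A = A} {x} x∈A y∈⁅x⁆ = subst (_∈ A) (sym (x∈⁅y⁆⇒x≡y x y∈⁅x⁆)) x∈A

m≤n∧n+o<m+p⇒n∸m<p∸o : ∀ {m n o p} → m ≤ n → n + o < m + p → n ∸ m < p ∸ o
m≤n∧n+o<m+p⇒n∸m<p∸o {m} {n} {o} {p} m≤n n+o<m+p =
  m+n≤o⇒m≤o∸n (suc (n ∸ m)) (+-cancelˡ-< m (n ∸ m + o) p (subst (_< m + p) n+o≡ n+o<m+p))
  where
  n+o≡ : n + o ≡ m + (n ∸ m + o)
  n+o≡ = trans (cong (_+ o) (sym (m+[n∸m]≡n m≤n))) (+-assoc m (n ∸ m) o)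

module _ {n : ℕ} (M : Matroid n) where
  open Matroid M

  r-∪-absorb : ∀ {A B} → B ⊆ A → r (A ∪ B) ≡ r A
  r-∪-absorb {A} {B} B⊆A = ≤-antisym (r-mono (∪-least ⊆-refl B⊆A)) (r-mono (p⊆p∪q B))

  rc-⊆ : ∀ {A B} → A ⊆ B → rc M B A ≡ r B ∸ r A
  rc-⊆ {A} A⊆B = cong (_∸ r A) (r-∪-absorb A⊆B)

  r-∪-cong : ∀ {A B} → A ⊆ B → r A ≡ r B → ∀ C → r (C ∪ A) ≡ r (C ∪ B)
  r-∪-cong {A} {B} A⊆B r[A]≡r[B] C =
    ≤-antisym (r-mono (∪-least (p⊆p∪q B) (⊆-trans A⊆B (q⊆p∪q C B))))
              (+-cancelʳ-≤ (r B) _ _ r[C∪B]+r[B]≤)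
    where
    open ≤-Reasoning
    r[C∪B]+r[B]≤ : r (C ∪ B) + r B ≤ r (C ∪ A) + r B
    r[C∪B]+r[B]≤ = begin
      r (C ∪ B) + r B
        ≤⟨ +-mono-≤ (r-mono (∪-least (⊆-trans (p⊆p∪q A) (p⊆p∪q B)) (q⊆p∪q (C ∪ A) B)))
                    (≤-trans (≤-reflexive (sym r[A]≡r[B])) (r-mono (∩-greatest (q⊆p∪q C A) A⊆B))) ⟩
      r ((C ∪ A) ∪ B) + r ((C ∪ A) ∩ B)
        ≤⟨ r-submod (C ∪ A) B ⟩
      r (C ∪ A) + r B ∎

  flat-closed : ∀ {F A} → IsFlat M F → r (F ∪ A) ≤ r F → A ⊆ F
  flat-closed {F} {A} flatF r[F∪A]≤r[F] {x} x∈A with x ∈? F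
  ... | yes x∈F = x∈F
  ... | no  x∉F = ⊥-elim (<-irrefl refl (begin-strict
        r F             <⟨ flatF x x∉F ⟩
        r (F ∪ ⁅ x ⁆)   ≤⟨ r-mono (∪-least (p⊆p∪q A) (⊆-trans (x∈p⇒⁅x⁆⊆p x∈A) (q⊆p∪q F A))) ⟩
        r (F ∪ A)       ≤⟨ r[F∪A]≤r[F] ⟩
        r F             ∎))
    where open ≤-Reasoning

  flat-⊆⊎< : ∀ {F} → IsFlat M F → ∀ A → A ⊆ F ⊎ r F < r (F ∪ A)
  flat-⊆⊎< {F} flatF A with r (F ∪ A) ≤? r F
  ... | yes r[F∪A]≤r[F] = inj₁ (flat-closed flatF r[F∪A]≤r[F])
  ... | no  r[F∪A]≰r[F] = inj₂ (≰⇒> r[F∪A]≰r[F])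

  nonmodular⇒rc< : ∀ {X Y} → Nonmodular M X Y → rc M Y X < r Y ∸ r (X ∩ Y)
  nonmodular⇒rc< {X} {Y} nonmodular =
    m≤n∧n+o<m+p⇒n∸m<p∸o (r-mono (q⊆p∪q Y X))
      (subst (λ U → r U + r (X ∩ Y) < r X + r Y) (∪-comm X Y)
        (≤∧≢⇒< (r-submod X Y) (λ modular → nonmodular (sym modular))))

  nonmodular⇒r<r[Y∪X′] : ∀ {X Y X′} → IsFlat M Y → Nonmodular M X Y →
                          X′ ⊆ X → rc M Y X′ ≡ rc M Y X → r Y < r (Y ∪ X′)
  nonmodular⇒r<r[Y∪X′] {X} {Y} {X′} flatY nonmodular X′⊆X rc≡ with flat-⊆⊎< flatY X′
  ... | inj₂ r[Y]<r[Y∪X′] = r[Y]<r[Y∪X′]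
  ... | inj₁ X′⊆Y = ⊥-elim (<-irrefl (sym rc≡) (begin-strict
        rc M Y X            <⟨ nonmodular⇒rc< nonmodular ⟩
        r Y ∸ r (X ∩ Y)     ≤⟨ ∸-monoʳ-≤ (r Y) (r-mono (∩-greatest X′⊆X X′⊆Y)) ⟩
        r Y ∸ r X′          ≡⟨ rc-⊆ X′⊆Y ⟨
        rc M Y X′           ∎))
    where open ≤-Reasoning

  self-quasiIntersection : ∀ {X Y} → IsFlat M X →
                           (∀ {X′} → X′ ⊆ X → rc M Y X′ ≡ rc M Y X → r X ≤ r X′) →
                           IsQuasiIntersection M X Y X
  self-quasiIntersection {X} {Y} flatX spans =
    flatX , rc≡0 ⊆-refl ≤-refl , λ _ _ X′⊆X → mk⇔ (rc-preserved X′⊆X) (rc≡0 X′⊆X ∘ spans X′⊆X)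
    where
    rc≡0 : ∀ {X′} → X′ ⊆ X → r X ≤ r X′ → rc M X X′ ≡ 0
    rc≡0 X′⊆X r[X]≤r[X′] = trans (rc-⊆ X′⊆X) (m≤n⇒m∸n≡0 r[X]≤r[X′])

    rc-preserved : ∀ {X′} → X′ ⊆ X → rc M X X′ ≡ 0 → rc M Y X′ ≡ rc M Y X
    rc-preserved {X′} X′⊆X rc[X∣X′]≡0 = cong₂ _∸_ (r-∪-cong X′⊆X r[X′]≡r[X] Y) r[X′]≡r[X]
      where
      r[X′]≡r[X] : r X′ ≡ r X
      r[X′]≡r[X] = ≤-antisym (r-mono X′⊆X) (m∸n≡0⇒m≤n (trans (sym (rc-⊆ X′⊆X)) rc[X∣X′]≡0))

  line-spans : ∀ {X Y X′} → Nonmodular M X Y → IsLine M X → r Y < r (Y ∪ X′) →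
               rc M Y X′ ≡ rc M Y X → r X ≤ r X′
  line-spans {X} {Y} {X′} nonmodular (_ , r[X]≡2) r[Y]<r[Y∪X′] rc≡ with r X ≤? r X′
  ... | yes r[X]≤r[X′] = r[X]≤r[X′]
  ... | no  r[X]≰r[X′] = ⊥-elim (<-irrefl (sym rc≡) (begin-strict
        rc M Y X          <⟨ nonmodular⇒rc< nonmodular ⟩
        r Y ∸ r (X ∩ Y)   ≤⟨ m∸n≤m (r Y) (r (X ∩ Y)) ⟩
        r Y               ≤⟨ m+n≤o⇒m≤o∸n (r Y) r[Y]+r[X′]≤r[Y∪X′] ⟩
        rc M Y X′         ∎))
    where
    open ≤-Reasoning
    r[Y]+r[X′]≤r[Y∪X′] : r Y + r X′ ≤ r (Y ∪ X′)
    r[Y]+r[X′]≤r[Y∪X′] = begin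
      r Y + r X′   ≤⟨ +-monoʳ-≤ (r Y) (≤-pred (subst (r X′ <_) r[X]≡2 (≰⇒> r[X]≰r[X′]))) ⟩
      r Y + 1      ≡⟨ +-comm (r Y) 1 ⟩
      suc (r Y)    ≤⟨ r[Y]<r[Y∪X′] ⟩
      r (Y ∪ X′)   ∎

  hyperplane-<⇒r≡r⊤ : ∀ {Y A} → IsHyperplane M Y → r Y < r (Y ∪ A) → r (Y ∪ A) ≡ r ⊤
  hyperplane-<⇒r≡r⊤ {Y} {A} (_ , r[Y]+1≡r[⊤]) r[Y]<r[Y∪A] =
    ≤-antisym (r-mono ⊆⊤) (subst (_≤ r (Y ∪ A)) (trans (+-comm 1 (r Y)) r[Y]+1≡r[⊤]) r[Y]<r[Y∪A])

  hyperplane-spans : ∀ {X Y X′} → IsHyperplane M Y → X′ ⊆ X → r Y < r (Y ∪ X′) →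
                     rc M Y X′ ≡ rc M Y X → r X ≤ r X′
  hyperplane-spans {X} {Y} {X′} hyperplaneY X′⊆X r[Y]<r[Y∪X′] rc≡ =
    ≤-reflexive (sym (∸-cancelˡ-≡ (r-mono ⊆⊤) (r-mono ⊆⊤) (begin
      r ⊤ ∸ r X′   ≡⟨ cong (_∸ r X′) (hyperplane-<⇒r≡r⊤ hyperplaneY r[Y]<r[Y∪X′]) ⟨
      rc M Y X′    ≡⟨ rc≡ ⟩
      rc M Y X     ≡⟨ cong (_∸ r X) (hyperplane-<⇒r≡r⊤ hyperplaneY r[Y]<r[Y∪X]) ⟩
      r ⊤ ∸ r X    ∎)))
    where
    open ≡-Reasoning
    r[Y]<r[Y∪X] : r Y < r (Y ∪ X)
    r[Y]<r[Y∪X] = <-≤-trans r[Y]<r[Y∪X′] (r-mono (∪-least (p⊆p∪q X) (⊆-trans X′⊆X (q⊆p∪q Y X))))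

lemma5p10 : {n : ℕ} (M : Matroid n) (X Y : Subset n) → IsFlat M X → IsFlat M Y → Nonmodular M X Y → IsLine M X ⊎ IsHyperplane M Y → IsQuasiIntersection M X Y X
lemma5p10 M X Y flatX flatY nonmodular lineX⊎hyperplaneY =
  self-quasiIntersection M flatX λ X′⊆X rc≡ →
    let r[Y]<r[Y∪X′] = nonmodular⇒r<r[Y∪X′] M flatY nonmodular X′⊆X rc≡ in
    [ (λ lineX → line-spans M nonmodular lineX r[Y]<r[Y∪X′] rc≡)
    , (λ hyperplaneY → hyperplane-spans M hyperplaneY X′⊆X r[Y]<r[Y∪X′] rc≡)
    ] lineX⊎hyperplaneY
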